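{- Let $(V,\mathcal{C},I=[1,q],\sigma)$ be an instance and $k\in[1,q-1]$. Let $S\in\mathcal{S}_k\setminus\mathcal{B}_k$ be a non-base solution, and let $T\in\mathcal{S}_k$ denote the lex-min solution of $S$. Write $I_\sigma(S)=\{k,i_1,\dots,i_p\}$ with $k<i_1<\dots<i_p$. Then for each $j\in[1,p]$, we have $i_j\in I_\sigma(T)$ if and only if $\mathcal{C}_{\max}(S;V_{\langle J\cup\{i_j\}\rangle})\ne\{S\}$, where $J=I_\sigma(T)\cap\{k,i_1,\dots,i_{j-1}\}$.
   Context: A set system $(V,\mathcal{C})$ consists of a finite totally ordered set $V$ and a family $\mathcal{C}\subseteq2^V$ of components. $\mathcal{C}_{\max}(Y)$ is the family of components $Z\subseteq Y$ such that no component $W$ satisfies $Z\subsetneq W\subseteq Y$. For $X\subseteq Y$, $\mathcal{C}_{\max}(X;Y)=\{C\in\mathcal{C}_{\max}(Y):X\subseteq C\}$. An instance is $(V,\mathcal{C},I,\sigma)$ with $I=[1,q]$ and $\sigma:V\to2^I$. Let $I_\sigma(X)=\bigcap_{v\in X}\sigma(v)$. A solution is a component $X$ such that every component $Y\supsetneq X$ has $I_\sigma(Y)\subsetneq I_\sigma(X)$; $\mathcal{S}$ is the family of solutions. For $i\in I$, $V_{\langle i\rangle}=\{v:i\in\sigma(v)\}$. For non-empty $J\subseteq I$, $V_{\langle J\rangle}=\{v:J\subseteq\sigma(v)\}$. $\min I_\sigma(X)$ is the least item of $I_\sigma(X)$, or $0$ if the set is empty. - $\mathcal{S}_k=\{X\in\mathcal{S}:\min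 I_\sigma(X)=k\}$; - $\mathcal{B}_k=\{X\in\mathcal{C}_{\max}(V_{\langle k\rangle}):\min I_\sigma(X)=k\}$. For subsets $J,K$ of a totally ordered set, write $J\prec K$ if the minimum element of the symmetric difference of $J$ and $K$ lies in $J$, and $J\preceq K$ if $J\prec K$ or $J=K$. For $X,Y\subseteq V$, write $(I_\sigma(X),X)\preceq(I_\sigma(Y),Y)$ if one of the following holds: - $I_\sigma(X)\prec I_\sigma(Y)$; - $I_\sigma(X)=I_\sigma(Y)$ and $X\prec Y$; - $X=Y$. For $X\subseteq V$ with $\min I_\sigma(X)=k\in[1,q-1]$: - a superset solution of $X$ is a solution $T\in\mathcal{S}_k$ with $T\supsetneq X$; - a superset solution is minimal if no proper subset of it is a superset solution of $X$; - the lex-min solution of $X$ is the minimal superset solution $T$ with $(I_\sigma(T),T)\preceq(I_\sigma(T'),T')$ for all minimal superset solutions $T'$ of $X$. -}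

module Defs where

open import Data.Nat using (ℕ; suc)
open import Data.Bool using (Bool; T; if_then_else_; _∧_)
open import Data.Fin using (Fin; toℕ; _<_; _≤_; _<?_)
open import Data.Fin.Subset using (Subset; _∈_; _∉_; _⊆_; _⊂_; _∩_; _∪_; ⋂; ⊤; ⁅_⁆)
open import Data.Fin.Subset.Properties using (_⊆?_)
open import Data.List using (List; map; allFin)
open import Data.Vec using (lookup; tabulate)
open import Data.Product using (_×_; ∃; Σ)
open import Data.Sum using (_⊎_)
open import Relation.Nullary using (¬_)
open import Relation.Nullary.Decidable using (⌊_⌋)
open import Relation.Binary.PropositionalEquality using (_≡_)
open import Function.Bundles using (_⇔_)

-- A set system on V = Fin n (ordered by the order of Fin) whose family of
-- components is given by its (decidable) indicator function.
-- Items I = [1,q] are represented by Fin q (item i+1 is the index i).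

Iσ : ∀ {n q} → (Fin n → Subset q) → Subset n → Subset q
Iσ {n} σ X = ⋂ (map (λ v → if lookup X v then σ v else ⊤) (allFin n))

V⟨_⟩ : ∀ {n q} → (Fin n → Subset q) → Subset q → Subset n
V⟨ σ ⟩ J = tabulate (λ v → ⌊ J ⊆? σ v ⌋)

_≺_ : ∀ {m} → Subset m → Subset m → Set
_≺_ {m} J K = ∃ λ (i : Fin m) → i ∈ J × i ∉ K × (∀ j → j < i → (j ∈ J ⇔ j ∈ K))

module Instance {n q : ℕ} (𝒞 : Subset n → Bool) (σ : Fin n → Subset q) where

  IsComp : Subset n → Set
  IsComp X = T (𝒞 X)

  InCmax : Subset n → Subset n → Set
  InCmax Y Z = IsComp Z × Z ⊆ Y × (∀ W → IsComp W → Z ⊂ W → ¬ (W ⊆ Y))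

  InCmax′ : Subset n → Subset n → Subset n → Set
  InCmax′ X Y C = InCmax Y C × X ⊆ C

  IsSolution : Subset n → Set
  IsSolution X = IsComp X × (∀ Y → IsComp Y → X ⊂ Y → Iσ σ Y ⊂ Iσ σ X)

  MinIs : Fin q → Subset q → Set
  MinIs k J = k ∈ J × (∀ i → i ∈ J → k ≤ i)

  InS : Fin q → Subset n → Set
  InS k X = IsSolution X × MinIs k (Iσ σ X)

  InB : Fin q → Subset n → Set
  InB k X = InCmax (V⟨ σ ⟩ ⁅ k ⁆) X × MinIs k (Iσ σ X)

  SupSol : Fin q → Subset n → Subset n → Set
  SupSol k X T = InS k T × X ⊂ T

  MinSupSol : Fin q → Subset n → Subset n → Set
  MinSupSol k X T = SupSol k X T × (∀ T′ → T′ ⊂ T → ¬ SupSol k X T′)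

  PairLe : Subset n → Subset n → Set
  PairLe A B = Iσ σ A ≺ Iσ σ B ⊎ (Iσ σ A ≡ Iσ σ B × A ≺ B) ⊎ A ≡ B

  LexMinSol : Fin q → Subset n → Subset n → Set
  LexMinSol k X T = MinSupSol k X T × (∀ T′ → MinSupSol k X T′ → PairLe T T′)

below : ∀ {q} → Subset q → Fin q → Subset q
below X b = tabulate (λ i → lookup X i ∧ ⌊ i <? b ⌋)

module Submission where

-- If i ∈ I(T), then T itself is a component of U = V_⟨J ∪ {i}⟩
-- strictly above S, so S is not maximal in U. Conversely, if S is not
-- maximal in U, pick a component W with S ⊊ W ⊆ U, enlarge it to a solution
-- with the same items, and shrink that to a minimal superset solution T′ of S.
-- Then J ∪ {i} ⊆ I(T′), while I(T) ⪯ I(T′) by lex-minimality of T; since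
-- I(T) and I(T′) agree on items of I(T) below i, the first item where they
-- differ cannot be i unless i ∈ I(T).

open import Defs
open import Data.Nat using (ℕ; suc; _<_)
open import Data.Bool using (Bool; T; true; false; if_then_else_)
open import Data.Bool.Properties using (T-≡; T-∧)
open import Data.Fin using (Fin; toℕ) renaming (_<_ to _<ᶠ_)
open import Data.Fin.Properties using (any?; <-cmp; ≤∧≢⇒<)
open import Data.Fin.Subset
  using (Subset; _∈_; _∉_; _⊆_; _⊈_; _⊂_; _⊃_; _∩_; _∪_; ⋂; ⊤; ⁅_⁆)
open import Data.Fin.Subset.Properties
  using ( _∈?_; _⊆?_; ∈⊤; ⊆-refl; ⊆-trans; ⊆-antisym; ⊂-⊆-trans; ⊂-irref; p∩q⊆p
        ; x∈p∩q⁺; x∈p∩q⁻; x∈p∪q⁻; p⊆p∪q; q⊆p∪q; x∈⁅x⁆; x∈⁅y⁆⇒x≡y)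
open import Data.Fin.Subset.Induction using (Acc; acc; ⊂-wellFounded; ⊃-wellFounded)
open import Data.List using (List; []; _∷_; map; allFin)
open import Data.List.Relation.Unary.All as All using (All; []; _∷_)
open import Data.List.Relation.Unary.All.Properties using (map⁺; map⁻)
open import Data.List.Membership.Propositional.Properties using (∈-allFin)
open import Data.Vec using (lookup; tabulate)
open import Data.Vec.Properties using (lookup∘tabulate; []=⇒lookup; lookup⇒[]=)
open import Data.Product using (_×_; _,_; proj₁; proj₂; ∃)
open import Data.Sum using (_⊎_; inj₁; inj₂)
open import Data.Empty using (⊥; ⊥-elim)
open import Relation.Nullary using (¬_; yes; no)
open import Relation.Nullary.Negation using (¬¬-map; contradiction)
open import Relation.Nullary.Decidable using (toWitness; fromWitness; decidable-stable; _×-dec_; ¬?)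
open import Relation.Binary.PropositionalEquality using (_≡_; refl; sym; trans; subst)
open import Relation.Binary.Definitions using (tri<; tri≈; tri>)
open import Function.Bundles using (_⇔_; mk⇔; Equivalence)

open Equivalence using (to; from)

private
  variable
    n q : ℕ

p⊆r∧r⊈p⇒p⊂r : {p r : Subset n} → p ⊆ r → r ⊈ p → p ⊂ r
p⊆r∧r⊈p⇒p⊂r {p = p} {r} p⊆r r⊈p with any? (λ x → x ∈? r ×-dec ¬? (x ∈? p))
... | yes (x , x∈r , x∉p) = p⊆r , x , x∈r , x∉p
... | no ∄x = ⊥-elim (r⊈p r⊆p)
  where
  r⊆p : r ⊆ p
  r⊆p {x} x∈r with x ∈? p
  ... | yes x∈p = x∈p
  ... | no x∉p = ⊥-elim (∄x (x , x∈r , x∉p))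

p⊆r∧x∈r⇒p∪⁅x⁆⊆r : {p r : Subset n} {x : Fin n} → p ⊆ r → x ∈ r → p ∪ ⁅ x ⁆ ⊆ r
p⊆r∧x∈r⇒p∪⁅x⁆⊆r {p = p} {x = x} p⊆r x∈r y∈p∪x with x∈p∪q⁻ p ⁅ x ⁆ y∈p∪x
... | inj₁ y∈p = p⊆r y∈p
... | inj₂ y∈⁅x⁆ rewrite x∈⁅y⁆⇒x≡y x y∈⁅x⁆ = x∈r

∈-tabulate⁺ : {g : Fin n → Bool} {x : Fin n} → T (g x) → x ∈ tabulate g
∈-tabulate⁺ {g = g} {x} gx =
  lookup⇒[]= x (tabulate g) (trans (lookup∘tabulate g x) (to T-≡ gx))

∈-tabulate⁻ : {g : Fin n → Bool} {x : Fin n} → x ∈ tabulate g → T (g x)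
∈-tabulate⁻ {g = g} {x} x∈ = from T-≡ (trans (sym (lookup∘tabulate g x)) ([]=⇒lookup x∈))

∈⋂⁺ : {ps : List (Subset n)} {x : Fin n} → All (x ∈_) ps → x ∈ ⋂ ps
∈⋂⁺ [] = ∈⊤
∈⋂⁺ (x∈p ∷ x∈ps) = x∈p∩q⁺ (x∈p , ∈⋂⁺ x∈ps)

∈⋂⁻ : (ps : List (Subset n)) {x : Fin n} → x ∈ ⋂ ps → All (x ∈_) ps
∈⋂⁻ [] _ = []
∈⋂⁻ (p ∷ ps) x∈ = let x∈p , x∈⋂ps = x∈p∩q⁻ p (⋂ ps) x∈ in x∈p ∷ ∈⋂⁻ ps x∈⋂ps

∈below⁺ : {X : Subset q} {b j : Fin q} → j ∈ X → j <ᶠ b → j ∈ below X b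
∈below⁺ j∈X j<b = ∈-tabulate⁺ (from T-∧ (from T-≡ ([]=⇒lookup j∈X) , fromWitness j<b))

∈below⁻ : {X : Subset q} {b j : Fin q} → j ∈ below X b → j ∈ X × j <ᶠ b
∈below⁻ {X = X} {j = j} j∈ =
  let j∈X , j<b = to T-∧ (∈-tabulate⁻ j∈) in lookup⇒[]= j X (to T-≡ j∈X) , toWitness j<b

∩below∪⁅⁆⊆ : {A X : Subset q} {i : Fin q} → i ∈ X → (A ∩ below X i) ∪ ⁅ i ⁆ ⊆ X
∩below∪⁅⁆⊆ {A = A} i∈X =
  p⊆r∧x∈r⇒p∪⁅x⁆⊆r (λ j∈ → proj₁ (∈below⁻ (proj₂ (x∈p∩q⁻ A _ j∈)))) i∈X

_⪯_ : Subset q → Subset q → Set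
A ⪯ B = A ≺ B ⊎ A ≡ B

-- The first item where A and B differ lies in A; it can be neither below i
-- (A ∩ [0,i) ⊆ B) nor above i (they would agree at i), so it is i itself.
⪯-∈ : {A B : Subset q} {i : Fin q} → A ⪯ B →
      (∀ {j} → j <ᶠ i → j ∈ A → j ∈ B) → i ∈ B → i ∈ A
⪯-∈ {i = i} (inj₁ (m , m∈A , m∉B , agree)) A⊆B-below i∈B with <-cmp m i
... | tri< m<i _ _ = contradiction (A⊆B-below m<i m∈A) m∉B
... | tri≈ _ refl _ = m∈A
... | tri> _ _ i<m = from (agree i i<m) i∈B
⪯-∈ (inj₂ refl) _ i∈B = i∈B

module _ {p} (P : Subset n → Set p) where

  Maximal : Subset n → Set p
  Maximal Z = ∀ W → Z ⊂ W → ¬ P W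

  Minimal : Subset n → Set p
  Minimal Z = ∀ W → W ⊂ Z → ¬ P W

  ¬¬-maximal-⊇ : {X : Subset n} → P X → ¬ ¬ (∃ λ Z → X ⊆ Z × P Z × Maximal Z)
  ¬¬-maximal-⊇ {X} = go X (⊃-wellFounded X)
    where
    go : ∀ X → Acc _⊃_ X → P X → ¬ ¬ (∃ λ Z → X ⊆ Z × P Z × Maximal Z)
    go X (acc rec) PX none = none (X , ⊆-refl , PX , λ W X⊂W PW →
      go W (rec X⊂W) PW λ (Z , W⊆Z , PZ , maxZ) →
        none (Z , ⊆-trans (proj₁ X⊂W) W⊆Z , PZ , maxZ))

  ¬¬-minimal-⊆ : {X : Subset n} → P X → ¬ ¬ (∃ λ Z → Z ⊆ X × P Z × Minimal Z)
  ¬¬-minimal-⊆ {X} = go X (⊂-wellFounded X)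
    where
    go : ∀ X → Acc _⊂_ X → P X → ¬ ¬ (∃ λ Z → Z ⊆ X × P Z × Minimal Z)
    go X (acc rec) PX none = none (X , ⊆-refl , PX , λ W W⊂X PW →
      go W (rec W⊂X) PW λ (Z , Z⊆W , PZ , minZ) →
        none (Z , ⊆-trans Z⊆W (proj₁ W⊂X) , PZ , minZ))

module _ {n q : ℕ} (σ : Fin n → Subset q) where

  ∈Iσ⁺ : {X : Subset n} {j : Fin q} → (∀ {v} → v ∈ X → j ∈ σ v) → j ∈ Iσ σ X
  ∈Iσ⁺ {X} {j} j∈σX = ∈⋂⁺ (map⁺ (All.universal j∈ (allFin n)))
    where
    j∈ : ∀ v → j ∈ (if lookup X v then σ v else ⊤)
    j∈ v with lookup X v in eq
    ... | true = j∈σX (lookup⇒[]= v X eq)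
    ... | false = ∈⊤

  ∈Iσ⁻ : {X : Subset n} {v : Fin n} → v ∈ X → Iσ σ X ⊆ σ v
  ∈Iσ⁻ {X} {v} v∈X {j} j∈ =
    subst (λ b → j ∈ (if b then σ v else ⊤)) ([]=⇒lookup v∈X)
      (All.lookup (map⁻ (∈⋂⁻ _ j∈)) (∈-allFin v))

  Iσ-antimono : {X Y : Subset n} → X ⊆ Y → Iσ σ Y ⊆ Iσ σ X
  Iσ-antimono X⊆Y j∈ = ∈Iσ⁺ (λ v∈X → ∈Iσ⁻ (X⊆Y v∈X) j∈)

  ⊆V⟨⟩⇔⊆Iσ : {X : Subset n} {J : Subset q} → X ⊆ V⟨ σ ⟩ J ⇔ J ⊆ Iσ σ X
  ⊆V⟨⟩⇔⊆Iσ = mk⇔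
    (λ X⊆V {j} j∈J → ∈Iσ⁺ (λ v∈X → toWitness (∈-tabulate⁻ (X⊆V v∈X)) j∈J))
    (λ J⊆I {v} v∈X → ∈-tabulate⁺ (fromWitness (λ {j} j∈J → ∈Iσ⁻ v∈X (J⊆I j∈J))))

module _ {n q : ℕ} (𝒞 : Subset n → Bool) (σ : Fin n → Subset q) where
  open Instance 𝒞 σ

  Cmax′≡⁅⁆⇔InCmax : {S U : Subset n} → IsComp S → S ⊆ U →
                     (∀ C → InCmax′ S U C ⇔ (C ≡ S)) ⇔ InCmax U S
  Cmax′≡⁅⁆⇔InCmax {S} {U} cS S⊆U = mk⇔ only⇒maximal maximal⇒only
    where
    only⇒maximal : (∀ C → InCmax′ S U C ⇔ (C ≡ S)) → InCmax U S
    only⇒maximal only = cS , S⊆U , λ W cW S⊂W W⊆U →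
      ¬¬-maximal-⊇ (λ Z → IsComp Z × Z ⊆ U) (cW , W⊆U) λ (Z , W⊆Z , (cZ , Z⊆U) , maxZ) →
        ⊂-irref (sym (to (only Z)
          ((cZ , Z⊆U , λ Y cY Z⊂Y Y⊆U → maxZ Y Z⊂Y (cY , Y⊆U)) , ⊆-trans (proj₁ S⊂W) W⊆Z)))
          (⊂-⊆-trans S⊂W W⊆Z)

    maximal⇒only : InCmax U S → ∀ C → InCmax′ S U C ⇔ (C ≡ S)
    maximal⇒only maxS@(_ , _ , noneAbove) C = mk⇔ in-Cmax′⇒≡S (λ { refl → maxS , ⊆-refl })
      where
      in-Cmax′⇒≡S : InCmax′ S U C → C ≡ S
      in-Cmax′⇒≡S ((cC , C⊆U , _) , S⊆C) with C ⊆? S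
      ... | yes C⊆S = ⊆-antisym C⊆S S⊆C
      ... | no C⊈S = ⊥-elim (noneAbove C cC (p⊆r∧r⊈p⇒p⊂r S⊆C C⊈S) C⊆U)

  -- A component that is maximal among those with at least the items of W is
  -- a solution, since any larger component must then lose an item.
  ¬¬-solution-⊇ : {W : Subset n} → IsComp W →
                  ¬ ¬ (∃ λ X → W ⊆ X × IsSolution X × Iσ σ W ⊆ Iσ σ X)
  ¬¬-solution-⊇ {W} cW = ¬¬-map isSolution (¬¬-maximal-⊇ P (cW , ⊆-refl))
    where
    P : Subset n → Set
    P Z = IsComp Z × Iσ σ W ⊆ Iσ σ Z

    isSolution : (∃ λ X → W ⊆ X × P X × Maximal P X) →
                 ∃ λ X → W ⊆ X × IsSolution X × Iσ σ W ⊆ Iσ σ X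
    isSolution (X , W⊆X , (cX , IW⊆IX) , maxX) =
      X , W⊆X , (cX , λ Y cY X⊂Y → p⊆r∧r⊈p⇒p⊂r (Iσ-antimono σ (proj₁ X⊂Y))
                  (λ IX⊆IY → maxX Y X⊂Y (cY , ⊆-trans IW⊆IX IX⊆IY))) , IW⊆IX

  ¬¬-supSol : {k : Fin q} {S W : Subset n} → InS k S → IsComp W → S ⊂ W → k ∈ Iσ σ W →
              ¬ ¬ (∃ λ X → SupSol k S X × Iσ σ W ⊆ Iσ σ X)
  ¬¬-supSol {k} {S} {W} (_ , _ , k≤IS) cW S⊂W k∈IW = ¬¬-map supSol (¬¬-solution-⊇ cW)
    where
    supSol : (∃ λ X → W ⊆ X × IsSolution X × Iσ σ W ⊆ Iσ σ X) →
             ∃ λ X → SupSol k S X × Iσ σ W ⊆ Iσ σ X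
    supSol (X , W⊆X , solX , IW⊆IX) =
      X , ((solX , IW⊆IX k∈IW , λ j j∈IX → k≤IS j (Iσ-antimono σ S⊆X j∈IX))
          , ⊂-⊆-trans S⊂W W⊆X)
        , IW⊆IX
      where
      S⊆X : S ⊆ X
      S⊆X = ⊆-trans (proj₁ S⊂W) W⊆X

  PairLe⇒Iσ-⪯ : {A B : Subset n} → PairLe A B → Iσ σ A ⪯ Iσ σ B
  PairLe⇒Iσ-⪯ (inj₁ IA≺IB) = inj₁ IA≺IB
  PairLe⇒Iσ-⪯ (inj₂ (inj₁ (IA≡IB , _))) = inj₂ IA≡IB
  PairLe⇒Iσ-⪯ (inj₂ (inj₂ refl)) = inj₂ refl

  lexMin-∈ : {k i : Fin q} {S T W : Subset n} → InS k S → LexMinSol k S T →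
             IsComp W → S ⊂ W → k ∈ Iσ σ W →
             (∀ {j} → j <ᶠ i → j ∈ Iσ σ T → j ∈ Iσ σ W) → i ∈ Iσ σ W → i ∈ Iσ σ T
  lexMin-∈ {k} {i} {S} {T} {W} S∈𝒮ₖ (_ , lexMin) cW S⊂W k∈IW IT⊆IW-below i∈IW =
    decidable-stable (i ∈? Iσ σ T) λ i∉IT →
      ¬¬-supSol S∈𝒮ₖ cW S⊂W k∈IW λ (X , supX , IW⊆IX) →
      ¬¬-minimal-⊆ (SupSol k S) supX λ (Y , Y⊆X , minY) →
      let IW⊆IY : Iσ σ W ⊆ Iσ σ Y
          IW⊆IY j∈ = Iσ-antimono σ Y⊆X (IW⊆IX j∈)
      in i∉IT (⪯-∈ (PairLe⇒Iσ-⪯ (lexMin Y minY))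
                   (λ j<i j∈IT → IW⊆IY (IT⊆IW-below j<i j∈IT)) (IW⊆IY i∈IW))

  lexMin-∈⇔¬maximal : {k i : Fin q} {S T : Subset n} → InS k S → LexMinSol k S T →
                      i ∈ Iσ σ S → ¬ (i ≡ k) →
                      (i ∈ Iσ σ T) ⇔ (¬ InCmax (V⟨ σ ⟩ ((Iσ σ T ∩ below (Iσ σ S) i) ∪ ⁅ i ⁆)) S)
  lexMin-∈⇔¬maximal {k} {i} {S} {T} S∈𝒮ₖ@((cS , _) , k∈IS , k≤IS)
                    lexT@((((solT , k∈IT , _) , S⊂T) , _) , _) i∈IS i≢k =
    mk⇔ (λ i∈IT (_ , _ , noneAbove) → noneAbove T (proj₁ solT) S⊂T (T⊆U i∈IT))
        (λ ¬maxS → decidable-stable (i ∈? IT) λ i∉IT → ¬maxS (maximal i∉IT))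
    where
    IT J : Subset q
    IT = Iσ σ T
    J = IT ∩ below (Iσ σ S) i

    U : Subset n
    U = V⟨ σ ⟩ (J ∪ ⁅ i ⁆)

    S⊆U : S ⊆ U
    S⊆U = from (⊆V⟨⟩⇔⊆Iσ σ) (∩below∪⁅⁆⊆ i∈IS)

    T⊆U : i ∈ IT → T ⊆ U
    T⊆U i∈IT = from (⊆V⟨⟩⇔⊆Iσ σ) (p⊆r∧x∈r⇒p∪⁅x⁆⊆r (p∩q⊆p IT _) i∈IT)

    k∈J : k ∈ J
    k∈J = x∈p∩q⁺ (k∈IT , ∈below⁺ k∈IS (≤∧≢⇒< (k≤IS i i∈IS) (λ k≡i → i≢k (sym k≡i))))

    IT⊆IS : IT ⊆ Iσ σ S
    IT⊆IS = Iσ-antimono σ (proj₁ S⊂T)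

    W⊆U⇒i∈IT : (W : Subset n) → IsComp W → S ⊂ W → W ⊆ U → i ∈ IT
    W⊆U⇒i∈IT W cW S⊂W W⊆U =
      lexMin-∈ S∈𝒮ₖ lexT cW S⊂W (J∪i⊆IW (p⊆p∪q _ k∈J))
        (λ j<i j∈IT → J∪i⊆IW (p⊆p∪q _ (x∈p∩q⁺ (j∈IT , ∈below⁺ (IT⊆IS j∈IT) j<i))))
        (J∪i⊆IW (q⊆p∪q J _ (x∈⁅x⁆ i)))
      where
      J∪i⊆IW : J ∪ ⁅ i ⁆ ⊆ Iσ σ W
      J∪i⊆IW = to (⊆V⟨⟩⇔⊆Iσ σ) W⊆U

    maximal : i ∉ IT → InCmax U S
    maximal i∉IT = cS , S⊆U , λ W cW S⊂W W⊆U → i∉IT (W⊆U⇒i∈IT W cW S⊂W W⊆U)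

lemma3 : {n q : ℕ} (𝒞 : Subset n → Bool) (σ : Fin n → Subset q)
    → let open Instance 𝒞 σ in
      (k : Fin q) → suc (toℕ k) < q
    → (S : Subset n) → InS k S → ¬ InB k S
    → (T : Subset n) → LexMinSol k S T
    → (i : Fin q) → i ∈ Iσ σ S → ¬ (i ≡ k)
    → ((i ∈ Iσ σ T) ⇔
        (¬ (∀ C → InCmax′ S (V⟨ σ ⟩ ((Iσ σ T ∩ below (Iσ σ S) i) ∪ ⁅ i ⁆)) C ⇔ (C ≡ S))))
lemma3 𝒞 σ _ _ S S∈𝒮ₖ _ T lexT i i∈IS i≢k =
  mk⇔ (λ i∈IT onlyS → to items i∈IT (to onlyS⇔maxS onlyS))
      (λ ¬onlyS → from items λ maxS → ¬onlyS (from onlyS⇔maxS maxS))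
  where
  open Instance 𝒞 σ

  U : Subset _
  U = V⟨ σ ⟩ ((Iσ σ T ∩ below (Iσ σ S) i) ∪ ⁅ i ⁆)

  items : (i ∈ Iσ σ T) ⇔ (¬ InCmax U S)
  items = lexMin-∈⇔¬maximal 𝒞 σ S∈𝒮ₖ lexT i∈IS i≢k

  onlyS⇔maxS : (∀ C → InCmax′ S U C ⇔ (C ≡ S)) ⇔ InCmax U S
  onlyS⇔maxS = Cmax′≡⁅⁆⇔InCmax 𝒞 σ (proj₁ (proj₁ S∈𝒮ₖ))
                 (from (⊆V⟨⟩⇔⊆Iσ σ) (∩below∪⁅⁆⊆ i∈IS))
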